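{- Let $M_1=(E,\mathcal I_1)$, $M_2=(E,\mathcal I_2)$ be matroids on a common finite ground set, $w:E\to\mathbb R_{\ge0}$, fix a stream order of $E$, and let $S$ and $g$ be as produced by Algorithm LR (see context). Then $g(S)\ge w(S^*)/2$, where $S^*$ is a maximum-$w$-weight set independent in both $M_1$ and $M_2$.
   Context: For a matroid $M$, $\mathrm{span}_M(X)=\{e:\mathrm{rank}_M(X\cup\{e\})=\mathrm{rank}_M(X)\}$; $h(A)=\sum_{a\in A}h(a)$. Algorithm LR: initialize $S=\emptyset$; elements arrive in stream order. When $e$ arrives, for $i=1,2$ compute $w_i^*(e)=\max\bigl(\{0\}\cup\{\theta: e\in\mathrm{span}_{M_i}(\{f\in S:w_i(f)\ge\theta\})\}\bigr)$. If $w(e)>w_1^*(e)+w_2^*(e)$, set $g(e)=w(e)-w_1^*(e)-w_2^*(e)$, $w_i(e)=w_i^*(e)+g(e)$ for $i=1,2$, and add $e$ to $S$; otherwise discard $e$. $S$ is the set at the end of the stream.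
   Formalization: The weight function $w$ takes values in the nonnegative rationals rather than $\mathbb R_{\ge0}$, so $w_i$ and $g$ are rational as well. -}

module Defs where

open import Data.Nat using (ℕ; _≤_)
open import Data.Fin using (Fin)
open import Data.Fin.Properties using () renaming (_≟_ to _≟ᶠ_)
open import Data.Fin.Subset using (Subset; ⊥; ⁅_⁆; _∪_; _∈_; _∉_; _⊆_; ∣_∣)
open import Data.Vec using (lookup; tabulate)
open import Data.Bool using (Bool; true; false; if_then_else_; _∧_)
open import Data.List using (List; []; _∷_; foldr; map)
open import Data.List.Base using (allFin)
open import Data.Product using (Σ; ∃; _×_; _,_)
open import Data.Sum using (_⊎_)
open import Relation.Nullary.Decidable using (⌊_⌋)
open import Relation.Binary.PropositionalEquality using (_≡_)
open import Data.Rational using (ℚ; 0ℚ; _+_; _-_) renaming (_≤_ to _≤ℚ_; _<_ to _<ℚ_)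
open import Data.Rational.Properties using () renaming (_≤?_ to _≤ℚ?_)

record Matroid (n : ℕ) : Set₁ where
  field
    Indep    : Subset n → Set
    indep-∅  : Indep ⊥
    indep-⊆  : ∀ {X Y} → Y ⊆ X → Indep X → Indep Y
    augment  : ∀ {X Y} → Indep X → Indep Y → ∣ X ∣ Data.Nat.< ∣ Y ∣ →
               ∃ λ e → e ∈ Y × e ∉ X × Indep (X ∪ ⁅ e ⁆)

open Matroid public

module _ {n : ℕ} (M : Matroid n) where

  IsRank : Subset n → ℕ → Set
  IsRank X r = (∃ λ Y → Y ⊆ X × Indep M Y × ∣ Y ∣ ≡ r)
             × (∀ Y → Y ⊆ X → Indep M Y → ∣ Y ∣ ≤ r)

  InSpan : Subset n → Fin n → Set
  InSpan X e = ∃ λ r → IsRank X r × IsRank (X ∪ ⁅ e ⁆) r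

sumOver : {n : ℕ} → (Fin n → ℚ) → Subset n → ℚ
sumOver {n} h A = foldr _+_ 0ℚ (map (λ a → if lookup A a then h a else 0ℚ) (allFin n))

superLevel : {n : ℕ} → Subset n → (Fin n → ℚ) → ℚ → Subset n
superLevel S wi θ = tabulate λ f → lookup S f ∧ ⌊ θ ≤ℚ? wi f ⌋

update : {n : ℕ} → (Fin n → ℚ) → Fin n → ℚ → (Fin n → ℚ)
update h e v x = if ⌊ x ≟ᶠ e ⌋ then v else h x

-- State of algorithm LR: the current set S and the functions w₁, w₂, g
-- (only their values on elements of S are ever used).
record LRState (n : ℕ) : Set where
  constructor ⟨_,_,_,_⟩
  field
    Sset : Subset n
    w₁   : Fin n → ℚ
    w₂   : Fin n → ℚ
    gfun : Fin n → ℚ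

initLR : {n : ℕ} → LRState n
initLR = ⟨ ⊥ , (λ _ → 0ℚ) , (λ _ → 0ℚ) , (λ _ → 0ℚ) ⟩

module _ {n : ℕ} (M : Matroid n) where

  Cond : Subset n → (Fin n → ℚ) → Fin n → ℚ → Set
  Cond S wi e θ = InSpan M (superLevel S wi θ) e

  IsWStar : Subset n → (Fin n → ℚ) → Fin n → ℚ → Set
  IsWStar S wi e t = (t ≡ 0ℚ ⊎ Cond S wi e t)
                   × 0ℚ ≤ℚ t
                   × (∀ θ → Cond S wi e θ → θ ≤ℚ t)

  -- The set { θ : Cond θ } is unbounded above, so the maximum is +∞
  -- (happens exactly when e is a loop of M); then e is discarded.
  WStarInfinite : Subset n → (Fin n → ℚ) → Fin n → Set
  WStarInfinite S wi e = ∀ θ → Cond S wi e θ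

data LRStep {n : ℕ} (M₁ M₂ : Matroid n) (w : Fin n → ℚ) (e : Fin n)
     : LRState n → LRState n → Set where
  discard-∞ : ∀ {S w₁ w₂ g} →
    WStarInfinite M₁ S w₁ e ⊎ WStarInfinite M₂ S w₂ e →
    LRStep M₁ M₂ w e ⟨ S , w₁ , w₂ , g ⟩ ⟨ S , w₁ , w₂ , g ⟩
  discard : ∀ {S w₁ w₂ g t₁ t₂} →
    IsWStar M₁ S w₁ e t₁ → IsWStar M₂ S w₂ e t₂ →
    w e ≤ℚ t₁ + t₂ →
    LRStep M₁ M₂ w e ⟨ S , w₁ , w₂ , g ⟩ ⟨ S , w₁ , w₂ , g ⟩
  add : ∀ {S w₁ w₂ g t₁ t₂} →
    IsWStar M₁ S w₁ e t₁ → IsWStar M₂ S w₂ e t₂ →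
    t₁ + t₂ <ℚ w e →
    LRStep M₁ M₂ w e ⟨ S , w₁ , w₂ , g ⟩
      ⟨ S ∪ ⁅ e ⁆
      , update w₁ e (t₁ + (w e - t₁ - t₂))
      , update w₂ e (t₂ + (w e - t₁ - t₂))
      , update g  e (w e - t₁ - t₂) ⟩

data LRRun {n : ℕ} (M₁ M₂ : Matroid n) (w : Fin n → ℚ)
     : List (Fin n) → LRState n → LRState n → Set where
  done : ∀ {s} → LRRun M₁ M₂ w [] s s
  step : ∀ {e es s s′ s″} → LRStep M₁ M₂ w e s s′ →
         LRRun M₁ M₂ w es s′ s″ → LRRun M₁ M₂ w (e ∷ es) s s″

IsMaxCommonIndep : {n : ℕ} → Matroid n → Matroid n → (Fin n → ℚ) → Subset n → Set
IsMaxCommonIndep M₁ M₂ w T =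
  Indep M₁ T × Indep M₂ T ×
  (∀ U → Indep M₁ U → Indep M₂ U → sumOver w U ≤ℚ sumOver w T)

{-# OPTIONS --safe #-}

-- Two invariants of LR give the bound.  Domination: for i = 1, 2 every
-- Mᵢ-independent I ⊆ S has wᵢ(I) ≤ g(S).  When e enters S with
-- wᵢ(e) = wᵢ*(e) + g(e), an independent I ∋ e either has wᵢ*(e) = 0 or, by
-- the exchange property, can trade e for an element of S of wᵢ-weight at
-- least wᵢ*(e); either way the old invariant pays for wᵢ(I - e) + wᵢ*(e) and
-- g(e) pays for the rest.  Covering: every element e carries thresholds
-- α₁, α₂ with w(e) ≤ α₁ + α₂, where αᵢ = wᵢ(e) if e ∈ S and αᵢ = wᵢ*(e) at
-- arrival otherwise; a discarded e stays spanned by elements of S of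
-- wᵢ-weight ≥ αᵢ, since these sets only grow.  Exchanging the discarded
-- elements of a common independent set T into S one at a time gives
-- αᵢ(T) ≤ wᵢ(I) ≤ g(S) for some Mᵢ-independent I ⊆ S, hence
-- w(T) ≤ α₁(T) + α₂(T) ≤ 2 g(S).

module Submission where

open import Defs
open LRState using (Sset)
open import Data.Nat using (ℕ; zero; suc) renaming (_≤_ to _≤ℕ_; _<_ to _<ℕ_; _+_ to _+ℕ_)
import Data.Nat.Properties as ℕ
open import Data.Fin using (Fin; zero; suc)
open import Data.Fin.Properties using () renaming (_≟_ to _≟ᶠ_)
open import Data.Fin.Subset using (Subset; ⊥; ⁅_⁆; _∪_; _-_; _∈_; _∉_; _⊆_; ∣_∣)
open import Data.Fin.Subset.Properties
  using (_∈?_; ∉⊥; x∈⁅x⁆; x∈⁅y⁆⇒x≡y; x∈p∪q⁻; p⊆p∪q; q⊆p∪q; ∪-identityʳ; p─⊥≡p; p─q⊆p;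
         x∈p∧x≢y⇒x∈p-y; p⊂q⇒∣p∣<∣q∣)
open import Data.Vec using ([]; _∷_; lookup; here; there)
open import Data.Bool using (Bool; true; false; if_then_else_)
open import Data.Bool.Properties using (if-eta; ∨-identityʳ)
open import Data.List using (List; []; _∷_; foldr)
open import Data.List.Base using (allFin)
open import Data.List.Properties using (map-tabulate)
open import Data.List.Membership.Propositional using () renaming (_∈_ to _∈ₗ_; _∉_ to _∉ₗ_)
open import Data.List.Membership.Propositional.Properties using (∈-allFin)
open import Data.List.Relation.Unary.Any using (here; there; toSum)
import Data.List.Relation.Unary.All as All
open import Data.List.Relation.Unary.AllPairs using (_∷_)
open import Data.List.Relation.Unary.Unique.Propositional using (Unique)
open import Data.List.Relation.Unary.Unique.Propositional.Properties using (allFin⁺)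
open import Data.List.Relation.Binary.Permutation.Propositional using (_↭_; ↭-sym; ↭⇒↭ₛ)
open import Data.List.Relation.Binary.Permutation.Propositional.Properties using (∈-resp-↭)
open import Data.List.Relation.Binary.Permutation.Setoid.Properties using (Unique-resp-↭)
open import Data.Product using (∃; _×_; _,_; proj₁; proj₂)
open import Data.Sum using (_⊎_; inj₁; inj₂; [_,_]′)
open import Function using (_∘_)
open import Relation.Nullary using (¬_; yes; no; contradiction)
open import Relation.Binary.PropositionalEquality
  using (_≡_; _≢_; refl; sym; trans; cong; cong₂; subst; subst₂; ≢-sym; setoid; module ≡-Reasoning)
open import Data.Rational using (ℚ; 0ℚ; ½; _*_; _≤_; _+_; _<_)
import Data.Rational as ℚ
open import Data.Rational.Properties
  using (≤-refl; ≤-trans; ≤-reflexive; ≤-antisym; <⇒≤; ≤-decTotalOrder;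
         +-mono-≤; +-monoˡ-≤; +-monoʳ-≤; *-monoˡ-≤-nonNeg;
         +-assoc; +-comm; +-identityˡ; +-identityʳ; +-inverseʳ; +-0-commutativeMonoid)
  renaming (_≤?_ to _≤ℚ?_)
open import Data.Rational.Solver using (module +-*-Solver)
open import Relation.Binary.Bundles using (DecTotalOrder)
import Relation.Binary.Reasoning.PartialOrder as PartialOrderReasoning
open import Algebra.Bundles using (CommutativeMonoid)
open import Algebra.Properties.CommutativeSemigroup
  (CommutativeMonoid.commutativeSemigroup +-0-commutativeMonoid) using (interchange)

private
  variable
    n : ℕ

module ≤-Reasoning = PartialOrderReasoning (DecTotalOrder.poset ≤-decTotalOrder)

p≤p+q : {p q : ℚ} → 0ℚ ≤ q → p ≤ p + q
p≤p+q {p} {q} 0≤q = subst (_≤ p + q) (+-identityʳ p) (+-monoʳ-≤ p 0≤q)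

halve : {p q : ℚ} → p ≤ q + q → ½ * p ≤ q
halve {p} {q} p≤2q = ≤-trans (*-monoˡ-≤-nonNeg ½ p≤2q) (≤-reflexive (½*[q+q]≡q q))
  where
  open +-*-Solver
  ½*[q+q]≡q : ∀ q → ½ * (q + q) ≡ q
  ½*[q+q]≡q = solve 1 (λ q → con ½ :* (q :+ q) := q) refl

gain-nonneg : {w t₁ t₂ : ℚ} → t₁ + t₂ < w → 0ℚ ≤ w ℚ.- t₁ ℚ.- t₂
gain-nonneg {w} {t₁} {t₂} t₁+t₂<w = begin
  0ℚ                         ≡⟨ sym (+-inverseʳ (t₁ + t₂)) ⟩
  (t₁ + t₂) ℚ.- (t₁ + t₂)    ≤⟨ +-monoˡ-≤ (ℚ.- (t₁ + t₂)) (<⇒≤ t₁+t₂<w) ⟩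
  w ℚ.- (t₁ + t₂)            ≡⟨ w-[t₁+t₂]≡w-t₁-t₂ w t₁ t₂ ⟩
  w ℚ.- t₁ ℚ.- t₂            ∎
  where
  open ≤-Reasoning
  open +-*-Solver
  w-[t₁+t₂]≡w-t₁-t₂ : ∀ w t₁ t₂ → w ℚ.- (t₁ + t₂) ≡ w ℚ.- t₁ ℚ.- t₂
  w-[t₁+t₂]≡w-t₁-t₂ = solve 3 (λ w t₁ t₂ → w :- (t₁ :+ t₂) := (w :- t₁) :- t₂) refl

gain-split : {w t₁ t₂ : ℚ} → 0ℚ ≤ w ℚ.- t₁ ℚ.- t₂ →
  w ≤ (t₁ + (w ℚ.- t₁ ℚ.- t₂)) + (t₂ + (w ℚ.- t₁ ℚ.- t₂))
gain-split {w} {t₁} {t₂} 0≤d =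
  ≤-trans (p≤p+q 0≤d) (≤-reflexive (sym (split w t₁ t₂)))
  where
  open +-*-Solver
  split : ∀ w t₁ t₂ → (t₁ + (w ℚ.- t₁ ℚ.- t₂)) + (t₂ + (w ℚ.- t₁ ℚ.- t₂))
                    ≡ w + (w ℚ.- t₁ ℚ.- t₂)
  split = solve 3 (λ w t₁ t₂ → (t₁ :+ ((w :- t₁) :- t₂)) :+ (t₂ :+ ((w :- t₁) :- t₂))
                             := w :+ ((w :- t₁) :- t₂)) refl

x∉p-x : {p : Subset n} (x : Fin n) → x ∉ p - x
x∉p-x {p = _ ∷ _} zero    ()
x∉p-x {p = _ ∷ _} (suc x) (there x∈p-x) = x∉p-x x x∈p-x

∪-lub : {p q r : Subset n} → p ⊆ r → q ⊆ r → p ∪ q ⊆ r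
∪-lub {p = p} {q} p⊆r q⊆r x∈p∪q with x∈p∪q⁻ p q x∈p∪q
... | inj₁ x∈p = p⊆r x∈p
... | inj₂ x∈q = q⊆r x∈q

x∈p⇒⁅x⁆⊆p : {p : Subset n} {x : Fin n} → x ∈ p → ⁅ x ⁆ ⊆ p
x∈p⇒⁅x⁆⊆p {p = p} {x} x∈p y∈⁅x⁆ = subst (_∈ p) (sym (x∈⁅y⁆⇒x≡y x y∈⁅x⁆)) x∈p

p-x∪⁅x⁆⊆p : {p : Subset n} {x : Fin n} → x ∈ p → (p - x) ∪ ⁅ x ⁆ ⊆ p
p-x∪⁅x⁆⊆p {p = p} {x} x∈p = ∪-lub (p─q⊆p p ⁅ x ⁆) (x∈p⇒⁅x⁆⊆p x∈p)

p⊆p-x∪q : {p q : Subset n} {x : Fin n} → x ∉ p ⊎ x ∈ q → p ⊆ (p - x) ∪ q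
p⊆p-x∪q {p = p} {q} {x} x∉p⊎x∈q {y} y∈p with y ≟ᶠ x | x∉p⊎x∈q
... | no y≢x  | _        = p⊆p∪q q (x∈p∧x≢y⇒x∈p-y y∈p y≢x)
... | yes refl | inj₁ y∉p = contradiction y∈p y∉p
... | yes refl | inj₂ y∈q = q⊆p∪q (p - x) q y∈q

x∉p⇒∣p∣<∣p∪⁅x⁆∣ : {p : Subset n} {x : Fin n} → x ∉ p → ∣ p ∣ <ℕ ∣ p ∪ ⁅ x ⁆ ∣
x∉p⇒∣p∣<∣p∪⁅x⁆∣ {p = p} {x} x∉p =
  p⊂q⇒∣p∣<∣q∣ (p⊆p∪q ⁅ x ⁆ , x , q⊆p∪q p ⁅ x ⁆ (x∈⁅x⁆ x) , x∉p)

sumOver-∷ : (h : Fin (suc n) → ℚ) (b : Bool) (A : Subset n) →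
  sumOver h (b ∷ A) ≡ (if b then h zero else 0ℚ) + sumOver (h ∘ suc) A
sumOver-∷ {n = n} h b A = cong ((if b then h zero else 0ℚ) +_) (cong (foldr _+_ 0ℚ)
  (trans (map-tabulate suc φ) (sym (map-tabulate (λ i → i) (φ ∘ suc)))))
  where
  φ : Fin (suc n) → ℚ
  φ a = if lookup (b ∷ A) a then h a else 0ℚ

sumOver-mono : {h h′ : Fin n → ℚ} (A : Subset n) →
  (∀ {i} → i ∈ A → h i ≤ h′ i) → sumOver h A ≤ sumOver h′ A
sumOver-mono [] _ = ≤-refl
sumOver-mono {h = h} {h′} (b ∷ A) h≤h′ =
  subst₂ _≤_ (sym (sumOver-∷ h b A)) (sym (sumOver-∷ h′ b A))
    (+-mono-≤ (head b h≤h′) (sumOver-mono A (h≤h′ ∘ there)))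
  where
  head : ∀ b → (∀ {i} → i ∈ b ∷ A → h i ≤ h′ i) →
         (if b then h zero else 0ℚ) ≤ (if b then h′ zero else 0ℚ)
  head true  h≤h′ = h≤h′ here
  head false _    = ≤-refl

sumOver-cong : {h h′ : Fin n → ℚ} (A : Subset n) →
  (∀ {i} → i ∈ A → h i ≡ h′ i) → sumOver h A ≡ sumOver h′ A
sumOver-cong A h≡h′ = ≤-antisym
  (sumOver-mono A (λ i∈A → ≤-reflexive (h≡h′ i∈A)))
  (sumOver-mono A (λ i∈A → ≤-reflexive (sym (h≡h′ i∈A))))

sumOver-0 : (A : Subset n) → sumOver (λ _ → 0ℚ) A ≡ 0ℚ
sumOver-0 []      = refl
sumOver-0 (b ∷ A) = begin
  sumOver (λ _ → 0ℚ) (b ∷ A)               ≡⟨ sumOver-∷ _ b A ⟩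
  (if b then 0ℚ else 0ℚ) + sumOver _ A     ≡⟨ cong₂ _+_ (if-eta b) (sumOver-0 A) ⟩
  0ℚ + 0ℚ                                  ≡⟨ +-identityʳ 0ℚ ⟩
  0ℚ                                       ∎
  where open ≡-Reasoning

sumOver-+ : (f g : Fin n → ℚ) (A : Subset n) →
  sumOver (λ e → f e + g e) A ≡ sumOver f A + sumOver g A
sumOver-+ f g []      = sym (+-identityʳ 0ℚ)
sumOver-+ f g (b ∷ A) = begin
  sumOver (λ e → f e + g e) (b ∷ A)
    ≡⟨ sumOver-∷ _ b A ⟩
  (if b then f zero + g zero else 0ℚ) + sumOver (λ e → f (suc e) + g (suc e)) A
    ≡⟨ cong₂ _+_ (head b) (sumOver-+ (f ∘ suc) (g ∘ suc) A) ⟩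
  ((if b then f zero else 0ℚ) + (if b then g zero else 0ℚ))
    + (sumOver (f ∘ suc) A + sumOver (g ∘ suc) A)
    ≡⟨ interchange (if b then f zero else 0ℚ) (if b then g zero else 0ℚ) _ _ ⟩
  ((if b then f zero else 0ℚ) + sumOver (f ∘ suc) A)
    + ((if b then g zero else 0ℚ) + sumOver (g ∘ suc) A)
    ≡⟨ sym (cong₂ _+_ (sumOver-∷ f b A) (sumOver-∷ g b A)) ⟩
  sumOver f (b ∷ A) + sumOver g (b ∷ A)
    ∎
  where
  open ≡-Reasoning
  head : ∀ b → (if b then f zero + g zero else 0ℚ)
             ≡ (if b then f zero else 0ℚ) + (if b then g zero else 0ℚ)
  head true  = refl
  head false = sym (+-identityʳ 0ℚ)

private
  sumOver-true∷ : (h : Fin (suc n) → ℚ) (A : Subset n) →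
    sumOver h (true ∷ A) ≡ sumOver h (false ∷ A) + h zero
  sumOver-true∷ h A = begin
    sumOver h (true ∷ A)               ≡⟨ sumOver-∷ h true A ⟩
    h zero + sumOver (h ∘ suc) A       ≡⟨ +-comm (h zero) _ ⟩
    sumOver (h ∘ suc) A + h zero
      ≡⟨ cong (_+ h zero) (sym (+-identityˡ (sumOver (h ∘ suc) A))) ⟩
    0ℚ + sumOver (h ∘ suc) A + h zero  ≡⟨ cong (_+ h zero) (sym (sumOver-∷ h false A)) ⟩
    sumOver h (false ∷ A) + h zero     ∎
    where open ≡-Reasoning

  sumOver-∷-+ : (h : Fin (suc n) → ℚ) (b : Bool) {A B : Subset n} {y : ℚ} →
    sumOver (h ∘ suc) B ≡ sumOver (h ∘ suc) A + y →
    sumOver h (b ∷ B) ≡ sumOver h (b ∷ A) + y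
  sumOver-∷-+ h b {A} {B} {y} eq = begin
    sumOver h (b ∷ B)              ≡⟨ sumOver-∷ h b B ⟩
    c + sumOver (h ∘ suc) B        ≡⟨ cong (c +_) eq ⟩
    c + (sumOver (h ∘ suc) A + y)  ≡⟨ sym (+-assoc c _ y) ⟩
    c + sumOver (h ∘ suc) A + y    ≡⟨ cong (_+ y) (sym (sumOver-∷ h b A)) ⟩
    sumOver h (b ∷ A) + y          ∎
    where
    open ≡-Reasoning
    c : ℚ
    c = if b then h zero else 0ℚ

sumOver-insert : (h : Fin n → ℚ) {A : Subset n} {x : Fin n} →
  x ∉ A → sumOver h (A ∪ ⁅ x ⁆) ≡ sumOver h A + h x
sumOver-insert h {true  ∷ A} {zero}  x∉A = contradiction here x∉A
sumOver-insert h {false ∷ A} {zero}  _   =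
  trans (cong (λ B → sumOver h (true ∷ B)) (∪-identityʳ A)) (sumOver-true∷ h A)
sumOver-insert h {b ∷ A}     {suc x} x∉A =
  trans (cong (λ c → sumOver h (c ∷ (A ∪ ⁅ x ⁆))) (∨-identityʳ b))
        (sumOver-∷-+ h b (sumOver-insert (h ∘ suc) (x∉A ∘ there)))

sumOver-remove : (h : Fin n → ℚ) {A : Subset n} {x : Fin n} →
  x ∈ A → sumOver h A ≡ sumOver h (A - x) + h x
sumOver-remove h {true ∷ A} here =
  trans (sumOver-true∷ h A) (cong (λ B → sumOver h (false ∷ B) + h zero) (sym (p─⊥≡p A)))
sumOver-remove h {b ∷ A} (there x∈A) = sumOver-∷-+ h b (sumOver-remove (h ∘ suc) x∈A)

update-≡ : (h : Fin n → ℚ) (x : Fin n) (c : ℚ) → update h x c x ≡ c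
update-≡ h x c with x ≟ᶠ x
... | yes _   = refl
... | no x≢x = contradiction refl x≢x

update-≢ : (h : Fin n → ℚ) {x y : Fin n} (c : ℚ) → y ≢ x → update h x c y ≡ h y
update-≢ h {x} {y} c y≢x with y ≟ᶠ x
... | yes y≡x = contradiction y≡x y≢x
... | no _    = refl

sumOver-update-+ : (h : Fin n → ℚ) (A : Subset n) {x : Fin n} {c d : ℚ} → 0ℚ ≤ d →
  sumOver (update h x (c + d)) A ≤ sumOver (update h x c) A + d
sumOver-update-+ h A {x} {c} {d} 0≤d with x ∈? A
... | yes x∈A = ≤-reflexive (begin
  sumOver (update h x (c + d)) A      ≡⟨ removed (c + d) ⟩
  sumOver h (A - x) + (c + d)         ≡⟨ sym (+-assoc (sumOver h (A - x)) c d) ⟩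
  sumOver h (A - x) + c + d           ≡⟨ cong (_+ d) (sym (removed c)) ⟩
  sumOver (update h x c) A + d        ∎)
  where
  open ≡-Reasoning
  removed : ∀ c → sumOver (update h x c) A ≡ sumOver h (A - x) + c
  removed c = trans (sumOver-remove _ x∈A) (cong₂ _+_
    (sumOver-cong (A - x) (λ {y} y∈A-x → update-≢ h c (λ { refl → x∉p-x x y∈A-x })))
    (update-≡ h x c))
... | no x∉A = begin
  sumOver (update h x (c + d)) A      ≡⟨ untouched (c + d) ⟩
  sumOver h A                         ≤⟨ p≤p+q 0≤d ⟩
  sumOver h A + d                     ≡⟨ cong (_+ d) (sym (untouched c)) ⟩
  sumOver (update h x c) A + d        ∎
  where
  open ≤-Reasoning
  untouched : ∀ c → sumOver (update h x c) A ≡ sumOver h A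
  untouched c = sumOver-cong A (λ y∈A → update-≢ h c (λ { refl → x∉A y∈A }))

sumOver-insert-update : (h : Fin n → ℚ) {A : Subset n} {x : Fin n} (c : ℚ) → x ∉ A →
  sumOver (update h x c) (A ∪ ⁅ x ⁆) ≡ sumOver h A + c
sumOver-insert-update h {A} {x} c x∉A = trans (sumOver-insert _ x∉A) (cong₂ _+_
  (sumOver-cong A (λ y∈A → update-≢ h c (λ { refl → x∉A y∈A })))
  (update-≡ h x c))

∈-superLevel⁻ : {S : Subset n} {wi : Fin n → ℚ} {θ : ℚ} {f : Fin n} →
  f ∈ superLevel S wi θ → f ∈ S × θ ≤ wi f
∈-superLevel⁻ {S = true  ∷ S} {wi} {θ} {zero} f∈ with θ ≤ℚ? wi zero
∈-superLevel⁻ {S = true  ∷ S} {wi} {θ} {zero} f∈ | yes θ≤wf = here , θ≤wf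
∈-superLevel⁻ {S = true  ∷ S} {wi} {θ} {zero} () | no _
∈-superLevel⁻ {S = _ ∷ S} {f = suc f} (there f∈) =
  let f∈S , θ≤wf = ∈-superLevel⁻ {S = S} f∈ in there f∈S , θ≤wf

∈-superLevel⁺ : {S : Subset n} {wi : Fin n → ℚ} {θ : ℚ} {f : Fin n} →
  f ∈ S → θ ≤ wi f → f ∈ superLevel S wi θ
∈-superLevel⁺ {wi = wi} {θ} here θ≤wf with θ ≤ℚ? wi zero
... | yes _   = here
... | no θ≰wf = contradiction θ≤wf θ≰wf
∈-superLevel⁺ (there f∈S) θ≤wf = there (∈-superLevel⁺ f∈S θ≤wf)

superLevel-insert : {S : Subset n} {wi : Fin n → ℚ} {x : Fin n} {c θ : ℚ} → x ∉ S →
  superLevel S wi θ ⊆ superLevel (S ∪ ⁅ x ⁆) (update wi x c) θ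
superLevel-insert {S = S} {wi} {x} {c} x∉S f∈ =
  let f∈S , θ≤wf = ∈-superLevel⁻ {S = S} f∈ in
  ∈-superLevel⁺ (p⊆p∪q ⁅ x ⁆ f∈S)
    (≤-trans θ≤wf (≤-reflexive (sym (update-≢ wi c (λ { refl → x∉S f∈S })))))

-- Matroids

module _ (M : Matroid n) where

  augment* : {Y Z : Subset n} → Indep M Y → Indep M Z →
    ∃ λ W → Y ⊆ W × W ⊆ Y ∪ Z × Indep M W × ∣ Z ∣ ≤ℕ ∣ W ∣
  augment* {Y} {Z} iY iZ = go ∣ Z ∣ iY (ℕ.m≤m+n ∣ Z ∣ ∣ Y ∣)
    where
    go : ∀ k {Y} → Indep M Y → ∣ Z ∣ ≤ℕ k +ℕ ∣ Y ∣ →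
         ∃ λ W → Y ⊆ W × W ⊆ Y ∪ Z × Indep M W × ∣ Z ∣ ≤ℕ ∣ W ∣
    go k {Y} iY ∣Z∣≤k+∣Y∣ with ∣ Z ∣ ℕ.≤? ∣ Y ∣
    ... | yes ∣Z∣≤∣Y∣ = Y , (λ y∈Y → y∈Y) , p⊆p∪q Z , iY , ∣Z∣≤∣Y∣
    go zero    iY ∣Z∣≤∣Y∣ | no ∣Z∣≰∣Y∣ = contradiction ∣Z∣≤∣Y∣ ∣Z∣≰∣Y∣
    go (suc k) {Y} iY ∣Z∣≤k+∣Y∣ | no ∣Z∣≰∣Y∣ with augment M iY iZ (ℕ.≰⇒> ∣Z∣≰∣Y∣)
    ... | a , a∈Z , a∉Y , iYa with go k iYa (ℕ.≤-trans ∣Z∣≤k+∣Y∣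
          (ℕ.≤-trans (ℕ.≤-reflexive (sym (ℕ.+-suc k ∣ Y ∣)))
                     (ℕ.+-monoʳ-≤ k (x∉p⇒∣p∣<∣p∪⁅x⁆∣ a∉Y))))
    ... | W , Ya⊆W , W⊆Ya∪Z , iW , ∣Z∣≤∣W∣ =
      W , (Ya⊆W ∘ p⊆p∪q ⁅ a ⁆) ,
      (∪-lub (∪-lub (p⊆p∪q Z) (q⊆p∪q Y Z ∘ x∈p⇒⁅x⁆⊆p a∈Z)) (q⊆p∪q Y Z) ∘ W⊆Ya∪Z) ,
      iW , ∣Z∣≤∣W∣

  basis∪spanned-dependent : {X Y : Subset n} {e : Fin n} {r : ℕ} →
    IsRank M (X ∪ ⁅ e ⁆) r → Y ⊆ X → ∣ Y ∣ ≡ r → e ∉ X → ¬ Indep M (Y ∪ ⁅ e ⁆)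
  basis∪spanned-dependent {X} {Y} {e} (_ , rank≤) Y⊆X ∣Y∣≡r e∉X iYe =
    ℕ.<-irrefl ∣Y∣≡r (ℕ.<-≤-trans (x∉p⇒∣p∣<∣p∪⁅x⁆∣ (e∉X ∘ Y⊆X))
      (rank≤ (Y ∪ ⁅ e ⁆) (∪-lub (p⊆p∪q ⁅ e ⁆ ∘ Y⊆X) (q⊆p∪q X ⁅ e ⁆)) iYe))

  -- Extend a basis Y of X inside Y ∪ J ∪ {e} to size ∣J∣ + 1.  The extension
  -- cannot contain e (Y + e would exceed the rank of X + e), so augmenting J
  -- from it adds an element of Y.
  spanned-exchange : {X J : Subset n} {e : Fin n} → InSpan M X e →
    Indep M J → e ∉ J → Indep M (J ∪ ⁅ e ⁆) →
    ∃ λ f → f ∈ X × f ∉ J × Indep M (J ∪ ⁅ f ⁆)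
  spanned-exchange {X} {J} {e} span iJ e∉J iJe with e ∈? X
  ... | yes e∈X = e , e∈X , e∉J , iJe
  ... | no e∉X with span
  ...   | r , ((Y , Y⊆X , iY , ∣Y∣≡r) , _) , rankXe with augment* iY iJe
  ...     | W , Y⊆W , W⊆Y∪Je , iW , ∣Je∣≤∣W∣ with e ∈? W
  ...       | yes e∈W = contradiction
                (indep-⊆ M (∪-lub Y⊆W (x∈p⇒⁅x⁆⊆p e∈W)) iW)
                (basis∪spanned-dependent rankXe Y⊆X ∣Y∣≡r e∉X)
  ...       | no e∉W with augment M iJ iW (ℕ.<-≤-trans (x∉p⇒∣p∣<∣p∪⁅x⁆∣ e∉J) ∣Je∣≤∣W∣)
  ...         | f , f∈W , f∉J , iJf = f , f∈X , f∉J , iJf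
    where
    f∈X : f ∈ X
    f∈X with x∈p∪q⁻ Y (J ∪ ⁅ e ⁆) (W⊆Y∪Je f∈W)
    ... | inj₁ f∈Y  = Y⊆X f∈Y
    ... | inj₂ f∈Je with x∈p∪q⁻ J ⁅ e ⁆ f∈Je
    ...   | inj₁ f∈J = contradiction f∈J f∉J
    ...   | inj₂ f∈⁅e⁆ = contradiction (subst (_∈ W) (x∈⁅y⁆⇒x≡y e f∈⁅e⁆) f∈W) e∉W

-- Weighted exchange

module _ (M : Matroid n) where

  -- Asking for a subset X of the super-level set, rather than the set itself,
  -- makes this monotone in S (superLevel-insert) without monotonicity of span.
  -- The nonpositive case is the 0 in max({0} ∪ …) defining wᵢ*.
  data SpannedAbove (S : Subset n) (wi : Fin n → ℚ) (e : Fin n) (α : ℚ) : Set where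
    nonpositive : α ≤ 0ℚ → SpannedAbove S wi e α
    spanned-by  : (X : Subset n) → X ⊆ superLevel S wi α → InSpan M X e → SpannedAbove S wi e α

  record Threshold (S : Subset n) (wi : Fin n → ℚ) (e : Fin n) (α : ℚ) : Set where
    field
      member    : e ∈ S → α ≡ wi e
      nonmember : e ∉ S → SpannedAbove S wi e α

  Dominates : Subset n → (Fin n → ℚ) → ℚ → Set
  Dominates S wi G = ∀ I → I ⊆ S → Indep M I → sumOver wi I ≤ G

  module _ {S : Subset n} {wi v : Fin n → ℚ} (agree : ∀ {e} → e ∈ S → v e ≡ wi e) where

    spanned-replace : {T : Subset n} {x : Fin n} → Indep M T → x ∈ T →
      SpannedAbove S wi x (v x) →
      ∃ λ T′ → Indep M T′ × T′ ⊆ (T - x) ∪ S × sumOver v T ≤ sumOver v T′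
    spanned-replace {T} {x} iT x∈T (nonpositive vx≤0) =
      T - x , indep-⊆ M (p─q⊆p T ⁅ x ⁆) iT , p⊆p∪q S , (begin
        sumOver v T               ≡⟨ sumOver-remove v x∈T ⟩
        sumOver v (T - x) + v x   ≤⟨ +-monoʳ-≤ (sumOver v (T - x)) vx≤0 ⟩
        sumOver v (T - x) + 0ℚ    ≡⟨ +-identityʳ (sumOver v (T - x)) ⟩
        sumOver v (T - x)         ∎)
      where open ≤-Reasoning
    spanned-replace {T} {x} iT x∈T (spanned-by X X⊆ span)
      with spanned-exchange M span (indep-⊆ M (p─q⊆p T ⁅ x ⁆) iT) (x∉p-x x)
                                   (indep-⊆ M (p-x∪⁅x⁆⊆p x∈T) iT)
    ... | f , f∈X , f∉T-x , iT′ with ∈-superLevel⁻ {S = S} (X⊆ f∈X)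
    ...   | f∈S , vx≤wf =
      (T - x) ∪ ⁅ f ⁆ , iT′ , ∪-lub (p⊆p∪q S) (q⊆p∪q (T - x) S ∘ x∈p⇒⁅x⁆⊆p f∈S) , (begin
        sumOver v T                  ≡⟨ sumOver-remove v x∈T ⟩
        sumOver v (T - x) + v x      ≤⟨ +-monoʳ-≤ (sumOver v (T - x)) vx≤wf ⟩
        sumOver v (T - x) + wi f     ≡⟨ cong (sumOver v (T - x) +_) (sym (agree f∈S)) ⟩
        sumOver v (T - x) + v f      ≡⟨ sym (sumOver-insert v f∉T-x) ⟩
        sumOver v ((T - x) ∪ ⁅ f ⁆)  ∎)
      where open ≤-Reasoning

    replace-if-outside : {T : Subset n} (x : Fin n) → Indep M T →
      (x ∈ T → x ∉ S → SpannedAbove S wi x (v x)) →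
      ∃ λ T′ → Indep M T′ × T′ ⊆ (T - x) ∪ S × sumOver v T ≤ sumOver v T′
    replace-if-outside {T} x iT spanned with x ∈? T | x ∈? S
    ... | yes x∈T | no x∉S  = spanned-replace iT x∈T (spanned x∈T x∉S)
    ... | yes _   | yes x∈S = T , iT , p⊆p-x∪q (inj₂ x∈S) , ≤-refl
    ... | no x∉T  | _       = T , iT , p⊆p-x∪q (inj₁ x∉T) , ≤-refl

    -- Exchange the elements of T outside S into S one at a time; xs lists the
    -- ones still to be handled.
    dominates-spanned : {G : ℚ} {T : Subset n} → Dominates S wi G → Indep M T →
      (∀ {e} → e ∈ T → e ∉ S → SpannedAbove S wi e (v e)) → sumOver v T ≤ G
    dominates-spanned {G} dom iT spanned =
      go (allFin n) iT (λ e∈T e∉S → ∈-allFin _ , spanned e∈T e∉S)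
      where
      Outside : List (Fin n) → Subset n → Set
      Outside xs T = ∀ {e} → e ∈ T → e ∉ S → e ∈ₗ xs × SpannedAbove S wi e (v e)

      go : ∀ xs {T} → Indep M T → Outside xs T → sumOver v T ≤ G
      go [] {T} iT out = ≤-trans (≤-reflexive (sumOver-cong T (agree ∘ T⊆S))) (dom T T⊆S iT)
        where
        T⊆S : T ⊆ S
        T⊆S {e} e∈T with e ∈? S
        ... | yes e∈S = e∈S
        ... | no e∉S with () ← proj₁ (out e∈T e∉S)
      go (x ∷ xs) {T} iT out with replace-if-outside x iT (λ x∈T x∉S → proj₂ (out x∈T x∉S))
      ... | T′ , iT′ , T′⊆ , vT≤vT′ = ≤-trans vT≤vT′ (go xs iT′ out′)
        where
        out′ : Outside xs T′
        out′ {e} e∈T′ e∉S with x∈p∪q⁻ (T - x) S (T′⊆ e∈T′)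
        ... | inj₂ e∈S   = contradiction e∈S e∉S
        ... | inj₁ e∈T-x with out (p─q⊆p T ⁅ x ⁆ e∈T-x) e∉S
        ...   | here refl  , _       = contradiction e∈T-x (x∉p-x x)
        ...   | there e∈xs , spanned = e∈xs , spanned

  zero-dominates : {S : Subset n} {G : ℚ} → 0ℚ ≤ G → Dominates S (λ _ → 0ℚ) G
  zero-dominates 0≤G I _ _ = ≤-trans (≤-reflexive (sumOver-0 I)) 0≤G

  dominates-thresholds : {S : Subset n} {wi v : Fin n → ℚ} {G : ℚ} {T : Subset n} →
    Dominates S wi G → Indep M T → (∀ e → Threshold S wi e (v e)) → sumOver v T ≤ G
  dominates-thresholds dom iT threshold =
    dominates-spanned (Threshold.member (threshold _)) dom iT
      (λ _ → Threshold.nonmember (threshold _))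

  dominates-insert : {S : Subset n} {wi : Fin n → ℚ} {x : Fin n} {t d G : ℚ} →
    Dominates S wi G → x ∉ S → SpannedAbove S wi x t → 0ℚ ≤ d →
    Dominates (S ∪ ⁅ x ⁆) (update wi x (t + d)) (G + d)
  dominates-insert {S} {wi} {x} {t} {d} {G} dom x∉S spanned 0≤d I I⊆ iI = begin
    sumOver (update wi x (t + d)) I  ≤⟨ sumOver-update-+ wi I 0≤d ⟩
    sumOver (update wi x t) I + d    ≤⟨ +-monoˡ-≤ d (dominates-spanned agree dom iI outside) ⟩
    G + d                            ∎
    where
    open ≤-Reasoning
    agree : ∀ {e} → e ∈ S → update wi x t e ≡ wi e
    agree e∈S = update-≢ wi t (λ { refl → x∉S e∈S })
    outside : ∀ {e} → e ∈ I → e ∉ S → SpannedAbove S wi e (update wi x t e)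
    outside e∈I e∉S with x∈p∪q⁻ S ⁅ x ⁆ (I⊆ e∈I)
    ... | inj₁ e∈S   = contradiction e∈S e∉S
    ... | inj₂ e∈⁅x⁆ rewrite x∈⁅y⁆⇒x≡y x e∈⁅x⁆ | update-≡ wi x t = spanned

  spannedAbove-insert : {S : Subset n} {wi : Fin n → ℚ} {x e : Fin n} {c α : ℚ} → x ∉ S →
    SpannedAbove S wi e α → SpannedAbove (S ∪ ⁅ x ⁆) (update wi x c) e α
  spannedAbove-insert x∉S (nonpositive α≤0)     = nonpositive α≤0
  spannedAbove-insert x∉S (spanned-by X X⊆ span) = spanned-by X (superLevel-insert x∉S ∘ X⊆) span

  threshold-insert : {S : Subset n} {wi : Fin n → ℚ} {x e : Fin n} {c α : ℚ} → x ∉ S → e ≢ x →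
    Threshold S wi e α → Threshold (S ∪ ⁅ x ⁆) (update wi x c) e α
  threshold-insert {S} {wi} {x} {e} {c} x∉S e≢x th = record
    { member    = λ e∈S∪x → trans (member (e∈S e∈S∪x)) (sym (update-≢ wi c e≢x))
    ; nonmember = λ e∉S∪x → spannedAbove-insert x∉S (nonmember (e∉S∪x ∘ p⊆p∪q ⁅ x ⁆)) }
    where
    open Threshold th
    e∈S : e ∈ S ∪ ⁅ x ⁆ → e ∈ S
    e∈S e∈S∪x with x∈p∪q⁻ S ⁅ x ⁆ e∈S∪x
    ... | inj₁ e∈S   = e∈S
    ... | inj₂ e∈⁅x⁆ = contradiction (x∈⁅y⁆⇒x≡y x e∈⁅x⁆) e≢x

  outside-threshold : {S : Subset n} {wi : Fin n → ℚ} {e : Fin n} {α : ℚ} → e ∉ S →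
    SpannedAbove S wi e α → Threshold S wi e α
  outside-threshold e∉S spanned = record
    { member = λ e∈S → contradiction e∈S e∉S ; nonmember = λ _ → spanned }

  wstar-spannedAbove : {S : Subset n} {wi : Fin n → ℚ} {e : Fin n} {t : ℚ} →
    IsWStar M S wi e t → SpannedAbove S wi e t
  wstar-spannedAbove (inj₁ t≡0 , _) = nonpositive (≤-reflexive t≡0)
  wstar-spannedAbove {S} {wi} {t = t} (inj₂ cond , _) =
    spanned-by (superLevel S wi t) (λ f∈ → f∈) cond

  infinite-spannedAbove : {S : Subset n} {wi : Fin n → ℚ} {e : Fin n} (α : ℚ) →
    WStarInfinite M S wi e → SpannedAbove S wi e α
  infinite-spannedAbove {S} {wi} α cond = spanned-by (superLevel S wi α) (λ f∈ → f∈) (cond α)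

-- Algorithm LR

module _ (M₁ M₂ : Matroid n) (w : Fin n → ℚ) where

  record Covered (s : LRState n) (e : Fin n) : Set where
    field
      α₁ α₂      : ℚ
      w≤α₁+α₂    : w e ≤ α₁ + α₂
      threshold₁ : Threshold M₁ (Sset s) (LRState.w₁ s) e α₁
      threshold₂ : Threshold M₂ (Sset s) (LRState.w₂ s) e α₂

  open Covered

  Dominated : LRState n → Set
  Dominated ⟨ S , w₁ , w₂ , g ⟩ = Dominates M₁ S w₁ (sumOver g S) × Dominates M₂ S w₂ (sumOver g S)

  fresh-step : {x y : Fin n} {s s′ : LRState n} → LRStep M₁ M₂ w x s s′ →
    y ∉ Sset s → y ≢ x → y ∉ Sset s′
  fresh-step (discard-∞ _)   y∉S _   = y∉S
  fresh-step (discard _ _ _) y∉S _   = y∉S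
  fresh-step {x} (add {S = S} _ _ _) y∉S y≢x y∈S∪x =
    [ y∉S , y≢x ∘ x∈⁅y⁆⇒x≡y x ]′ (x∈p∪q⁻ S ⁅ x ⁆ y∈S∪x)

  covered-new : {x : Fin n} {s s′ : LRState n} → LRStep M₁ M₂ w x s s′ →
    x ∉ Sset s → Covered s′ x
  covered-new {x} (discard-∞ (inj₁ ∞₁)) x∉S = record
    { α₁ = w x ; α₂ = 0ℚ ; w≤α₁+α₂ = ≤-reflexive (sym (+-identityʳ (w x)))
    ; threshold₁ = outside-threshold M₁ x∉S (infinite-spannedAbove M₁ (w x) ∞₁)
    ; threshold₂ = outside-threshold M₂ x∉S (nonpositive ≤-refl) }
  covered-new {x} (discard-∞ (inj₂ ∞₂)) x∉S = record
    { α₁ = 0ℚ ; α₂ = w x ; w≤α₁+α₂ = ≤-reflexive (sym (+-identityˡ (w x)))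
    ; threshold₁ = outside-threshold M₁ x∉S (nonpositive ≤-refl)
    ; threshold₂ = outside-threshold M₂ x∉S (infinite-spannedAbove M₂ (w x) ∞₂) }
  covered-new (discard {t₁ = t₁} {t₂} W₁ W₂ w≤t₁+t₂) x∉S = record
    { α₁ = t₁ ; α₂ = t₂ ; w≤α₁+α₂ = w≤t₁+t₂
    ; threshold₁ = outside-threshold M₁ x∉S (wstar-spannedAbove M₁ W₁)
    ; threshold₂ = outside-threshold M₂ x∉S (wstar-spannedAbove M₂ W₂) }
  covered-new {x} (add {S = S} {w₁} {w₂} {t₁ = t₁} {t₂} _ _ t₁+t₂<w) _ = record
    { α₁ = t₁ + d ; α₂ = t₂ + d ; w≤α₁+α₂ = gain-split {w x} {t₁} {t₂} (gain-nonneg t₁+t₂<w)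
    ; threshold₁ = record { member = λ _ → sym (update-≡ w₁ x (t₁ + d)) ; nonmember = added }
    ; threshold₂ = record { member = λ _ → sym (update-≡ w₂ x (t₂ + d)) ; nonmember = added } }
    where
    d : ℚ
    d = w x ℚ.- t₁ ℚ.- t₂
    added : {P : Set} → x ∉ S ∪ ⁅ x ⁆ → P
    added x∉S∪x = contradiction (q⊆p∪q S ⁅ x ⁆ (x∈⁅x⁆ x)) x∉S∪x

  covered-old : {x e : Fin n} {s s′ : LRState n} → LRStep M₁ M₂ w x s s′ →
    x ∉ Sset s → e ≢ x → Covered s e → Covered s′ e
  covered-old (discard-∞ _)   _   _   cov = cov
  covered-old (discard _ _ _) _   _   cov = cov
  covered-old (add _ _ _)     x∉S e≢x cov = record
    { α₁ = α₁ cov ; α₂ = α₂ cov ; w≤α₁+α₂ = w≤α₁+α₂ cov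
    ; threshold₁ = threshold-insert M₁ x∉S e≢x (threshold₁ cov)
    ; threshold₂ = threshold-insert M₂ x∉S e≢x (threshold₂ cov) }

  dominated-step : {x : Fin n} {s s′ : LRState n} → LRStep M₁ M₂ w x s s′ →
    x ∉ Sset s → Dominated s → Dominated s′
  dominated-step (discard-∞ _)   _ dom = dom
  dominated-step (discard _ _ _) _ dom = dom
  dominated-step {x} (add {S = S} {g = g} {t₁} {t₂} W₁ W₂ t₁+t₂<w) x∉S (dom₁ , dom₂) =
    subst (Dominates M₁ _ _) gS′ (dominates-insert M₁ dom₁ x∉S (wstar-spannedAbove M₁ W₁) 0≤d) ,
    subst (Dominates M₂ _ _) gS′ (dominates-insert M₂ dom₂ x∉S (wstar-spannedAbove M₂ W₂) 0≤d)
    where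
    d : ℚ
    d = w x ℚ.- t₁ ℚ.- t₂
    0≤d : 0ℚ ≤ d
    0≤d = gain-nonneg {w x} {t₁} {t₂} t₁+t₂<w
    gS′ : sumOver g S + d ≡ sumOver (update g x d) (S ∪ ⁅ x ⁆)
    gS′ = sym (sumOver-insert-update g d x∉S)

  dominated-init : Dominated (initLR {n})
  dominated-init = zero-dominates M₁ 0≤g⊥ , zero-dominates M₂ 0≤g⊥
    where
    0≤g⊥ : 0ℚ ≤ sumOver (λ _ → 0ℚ) (⊥ {n})
    0≤g⊥ = ≤-reflexive (sym (sumOver-0 (⊥ {n})))

  run-invariant : {es : List (Fin n)} {s s″ : LRState n} → LRRun M₁ M₂ w es s s″ →
    Unique es → (∀ {y} → y ∈ₗ es → y ∉ Sset s) → (∀ {e} → e ∉ₗ es → Covered s e) →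
    Dominated s → (∀ e → Covered s″ e) × Dominated s″
  run-invariant done _ _ covered dom = (λ e → covered (λ ())) , dom
  run-invariant {x ∷ es} {s} (step {s′ = s′} st run) (x∉es ∷ unique) fresh covered dom =
    run-invariant run unique fresh′ covered′ (dominated-step st x∉S dom)
    where
    x∉S : x ∉ Sset s
    x∉S = fresh (here refl)
    fresh′ : ∀ {y} → y ∈ₗ es → y ∉ Sset s′
    fresh′ y∈es = fresh-step st (fresh (there y∈es)) (≢-sym (All.lookup x∉es y∈es))
    covered′ : ∀ {e} → e ∉ₗ es → Covered s′ e
    covered′ {e} e∉es with e ≟ᶠ x
    ... | yes refl = covered-new st x∉S
    ... | no e≢x   = covered-old st x∉S e≢x (covered ([ e≢x , e∉es ]′ ∘ toSum))

  final-invariant : {stream : List (Fin n)} {final : LRState n} →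
    stream ↭ allFin n → LRRun M₁ M₂ w stream initLR final →
    (∀ e → Covered final e) × Dominated final
  final-invariant stream↭allFin run = run-invariant run
    (Unique-resp-↭ (setoid (Fin n)) (↭⇒↭ₛ (↭-sym stream↭allFin)) (allFin⁺ n))
    (λ _ → ∉⊥)
    (λ e∉stream → contradiction (∈-resp-↭ (↭-sym stream↭allFin) (∈-allFin _)) e∉stream)
    dominated-init

  half-of-common-independent : {stream : List (Fin n)} {final : LRState n} →
    stream ↭ allFin n → LRRun M₁ M₂ w stream initLR final →
    {T : Subset n} → Indep M₁ T → Indep M₂ T →
    ½ * sumOver w T ≤ sumOver (LRState.gfun final) (Sset final)
  half-of-common-independent {final = ⟨ S , w₁ , w₂ , g ⟩} stream↭allFin run {T} iT₁ iT₂
    with final-invariant stream↭allFin run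
  ... | cov , dom₁ , dom₂ = halve (begin
    sumOver w T                                  ≤⟨ sumOver-mono T (λ _ → w≤α₁+α₂ (cov _)) ⟩
    sumOver (λ e → α₁ (cov e) + α₂ (cov e)) T    ≡⟨ sumOver-+ _ _ T ⟩
    sumOver (α₁ ∘ cov) T + sumOver (α₂ ∘ cov) T  ≤⟨ +-mono-≤
      (dominates-thresholds M₁ dom₁ iT₁ (threshold₁ ∘ cov))
      (dominates-thresholds M₂ dom₂ iT₂ (threshold₂ ∘ cov)) ⟩
    sumOver g S + sumOver g S                    ∎)
    where open ≤-Reasoning

lemma3p4 : (n : ℕ) (M₁ M₂ : Matroid n) (w : Fin n → ℚ) →
    (∀ e → 0ℚ ≤ w e) →
    (stream : List (Fin n)) → stream ↭ allFin n →
    (final : LRState n) → LRRun M₁ M₂ w stream initLR final →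
    (Sstar : Subset n) → IsMaxCommonIndep M₁ M₂ w Sstar →
    ½ * sumOver w Sstar ≤ sumOver (LRState.gfun final) (LRState.Sset final)
lemma3p4 n M₁ M₂ w _ stream stream↭allFin final run Sstar (iS₁ , iS₂ , _) =
  half-of-common-independent M₁ M₂ w stream↭allFin run iS₁ iS₂
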